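{- Let $\mathcal{M}=\langle W,R_1,R_2,V\rangle$ be a model and $R=R_1\setminus R_2$. For any $\langle\mathcal{M},w\rangle\in\mathfrak{M}^\bullet$ and any $\varphi\in\mathcal{L}_{\langle-\rangle_2}$, we have $\mathcal{M},w\models\varphi\Leftrightarrow\langle W,R,V\rangle,w\models\varphi'$, where $\varphi'$ is the sabotage modal logic (SML) formula obtained by replacing every occurrence of $\langle-\rangle_2$ in $\varphi$ with the sabotage modality $\langle-\rangle$.
   Context: Fix a countable set $\mathbf{P}$ of atoms. The language $\mathcal{L}$ of SLL is $\varphi::=p\mid\neg\varphi\mid(\varphi\land\varphi)\mid\Diamond_L\varphi\mid\langle-\rangle_1\varphi\mid\langle-\rangle_2\varphi\mid\langle+\rangle\varphi$ ($\Diamond_L$ is the learner-move modality, drawn as a black diamond in the paper); $\mathcal{L}_{\langle-\rangle_2}$ is the fragment whose only modality is $\langle-\rangle_2$. A model is $\mathcal{M}=\langle W,R_1,R_2,V\rangle$ with $W\neq\emptyset$, $R_1,R_2\subseteq W^2$, $V:\mathbf{P}\to2^W$. For a finite non-empty sequence $S$ of worlds, $e(S)$ is its last element and $Set(S)$ is the set of pairs of consecutive elements of $S$ ($\emptyset$ for a singleton). A pointed model $\langle\mathcal{M},S\rangle$ requires $Set(S)\subseteq R_1$; $\mathfrak{M}^\bullet$ is the class of pointed models whose sequence is a singleton $\langle w\rangle$ (written $\mathcal{M},w$). $\mathcal{M}\ominus\langle v,v'\rangle=\langle W,R_1\setminus\{\langle v,v'\rangle\},R_2,V\rangle$. Semantics: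 $\mathcal{M},S\models p$ iff $e(S)\in V(p)$; Booleans as usual; $\mathcal{M},S\models\langle-\rangle_2\varphi$ iff there is $\langle v,v'\rangle\in(R_1\setminus R_2)\setminus Set(S)$ with $\mathcal{M}\ominus\langle v,v'\rangle,S\models\varphi$. In SML, on a Kripke model $\langle W,R,V\rangle$, $\langle-\rangle\psi$ holds at $w$ iff there is $\langle v,v'\rangle\in R$ with $\langle W,R\setminus\{\langle v,v'\rangle\},V\rangle,w\models\psi$. -}

module Defs where

open import Data.Nat using (ℕ)
open import Data.Product using (_×_; Σ; _,_)
open import Data.Sum using (_⊎_)
open import Data.List using (List; []; _∷_)
open import Data.Empty using (⊥)
open import Relation.Nullary using (¬_)
open import Relation.Binary.PropositionalEquality using (_≡_)

Atom : Set
Atom = ℕ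

Rel : Set → Set₁
Rel W = W → W → Set

_∖_ : {W : Set} → Rel W → Rel W → Rel W
(R ∖ R') x y = R x y × ¬ R' x y

remove : {W : Set} → Rel W → W → W → Rel W
remove R v v' x y = R x y × ¬ (x ≡ v × y ≡ v')

-- Models of SLL: M = ⟨W, R₁, R₂, V⟩.  (W ≠ ∅ is witnessed by the
-- world w of the pointed model in the statement.)
record Model : Set₁ where
  constructor model
  field
    W  : Set
    R₁ : Rel W
    R₂ : Rel W
    V  : Atom → W → Set

open Model public

_⊖_ : (M : Model) → W M × W M → Model
M ⊖ (v , v') = model (W M) (remove (R₁ M) v v') (R₂ M) (V M)

record Seq (A : Set) : Set where
  constructor seq
  field
    hd : A
    tl : List A

lastOf : {A : Set} → A → List A → A
lastOf x []       = x
lastOf _ (y ∷ ys) = lastOf y ys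

e : {A : Set} → Seq A → A
e (seq x xs) = lastOf x xs

InPairs : {A : Set} → A → List A → A → A → Set
InPairs x []       a b = ⊥
InPairs x (y ∷ ys) a b = (a ≡ x × b ≡ y) ⊎ InPairs y ys a b

SetS : {A : Set} → Seq A → A → A → Set
SetS (seq x xs) a b = InPairs x xs a b

single : {A : Set} → A → Seq A
single w = seq w []

data Form : Set where
  atom : Atom → Form
  ¬'_  : Form → Form
  _∧'_ : Form → Form → Form
  ⟨-⟩₂ : Form → Form

_,_⊨_ : (M : Model) → Seq (W M) → Form → Set
M , S ⊨ atom p   = V M p (e S)
M , S ⊨ (¬' φ)   = ¬ (M , S ⊨ φ)
M , S ⊨ (φ ∧' ψ) = (M , S ⊨ φ) × (M , S ⊨ ψ)
M , S ⊨ ⟨-⟩₂ φ   =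
  Σ (W M) λ v → Σ (W M) λ v' →
    ((R₁ M ∖ R₂ M) v v' × ¬ SetS S v v') × ((M ⊖ (v , v')) , S ⊨ φ)

data SForm : Set where
  atom : Atom → SForm
  ¬'_  : SForm → SForm
  _∧'_ : SForm → SForm → SForm
  ⟨-⟩  : SForm → SForm

record Kripke : Set₁ where
  constructor kripke
  field
    KW : Set
    KR : Rel KW
    KV : Atom → KW → Set

open Kripke public

_⊨ₛ_at_ : (K : Kripke) → SForm → KW K → Set
K ⊨ₛ atom p at w   = KV K p w
K ⊨ₛ (¬' φ) at w   = ¬ (K ⊨ₛ φ at w)
K ⊨ₛ (φ ∧' ψ) at w = (K ⊨ₛ φ at w) × (K ⊨ₛ ψ at w)
K ⊨ₛ ⟨-⟩ φ at w    =
  Σ (KW K) λ v → Σ (KW K) λ v' →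
    KR K v v' × (kripke (KW K) (remove (KR K) v v') (KV K) ⊨ₛ φ at w)

translate : Form → SForm
translate (atom p) = atom p
translate (¬' φ)   = ¬' translate φ
translate (φ ∧' ψ) = translate φ ∧' translate ψ
translate (⟨-⟩₂ φ) = ⟨-⟩ (translate φ)

-- Over a singleton sequence no edge is ever protected by Set(S), so ⟨-⟩₂ deletes an
-- arbitrary edge of R₁ ∖ R₂ and leaves R₂ untouched. Deleting an edge from R₁ and then
-- subtracting R₂ is the same as deleting it from R₁ ∖ R₂, so the SLL model and the
-- Kripke model ⟨W, R₁ ∖ R₂, V⟩ stay in step. These two relations are equivalent but not
-- equal, so the induction on φ is run for any R equivalent to R₁ ∖ R₂.
module Submission where

open import Defs
open import Data.Product using (_×_; Σ; _,_; proj₁; proj₂)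
open import Data.Product.Function.Dependent.Propositional using (Σ-⇔)
open import Data.Product.Function.NonDependent.Propositional using (_×-⇔_)
open import Function.Bundles using (_⇔_; mk⇔)
open import Function.Construct.Composition using (_⇔-∘_)
open import Function.Construct.Identity using (↠-id; ⇔-id)
open import Function.Related.TypeIsomorphisms using (¬-cong-⇔)
open import Relation.Binary.Core using () renaming (_⇔_ to _⇔ᵣ_)
open import Relation.Nullary using (¬_)

remove-cong-∖ : {W : Set} {R R₁ R₂ : Rel W} → R ⇔ᵣ R₁ ∖ R₂ →
                (v v' : W) → remove R v v' ⇔ᵣ remove R₁ v v' ∖ R₂
remove-cong-∖ (R⇒ , ⇒R) v v' =
    (λ (r , ne) → (proj₁ (R⇒ r) , ne) , proj₂ (R⇒ r))
  , (λ ((r₁ , ne) , ¬r₂) → ⇒R (r₁ , ¬r₂) , ne)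

single-unprotected : {W : Set} (w v v' : W) → ¬ SetS (single w) v v'
single-unprotected w v v' ()

×-unprotected-⇔ : {W A : Set} (w v v' : W) → (A × ¬ SetS (single w) v v') ⇔ A
×-unprotected-⇔ w v v' = mk⇔ proj₁ (λ a → a , single-unprotected w v v')

∃₂-cong-⇔ : {W : Set} {P Q : W → W → Set} →
            (∀ v v' → P v v' ⇔ Q v v') → Σ W (λ v → Σ W (P v)) ⇔ Σ W (λ v → Σ W (Q v))
∃₂-cong-⇔ P⇔Q = Σ-⇔ (↠-id _) (Σ-⇔ (↠-id _) (P⇔Q _ _))

single-⊨⇔⊨ₛ-translate : (M : Model) {R : Rel (W M)} → R ⇔ᵣ R₁ M ∖ R₂ M →
                         (w : W M) (φ : Form) →
                         (M , single w ⊨ φ) ⇔ (kripke (W M) R (V M) ⊨ₛ translate φ at w)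
single-⊨⇔⊨ₛ-translate M R⇔ w (atom p) = ⇔-id _
single-⊨⇔⊨ₛ-translate M R⇔ w (¬' φ)   = ¬-cong-⇔ (single-⊨⇔⊨ₛ-translate M R⇔ w φ)
single-⊨⇔⊨ₛ-translate M R⇔ w (φ ∧' ψ) =
  single-⊨⇔⊨ₛ-translate M R⇔ w φ ×-⇔ single-⊨⇔⊨ₛ-translate M R⇔ w ψ
single-⊨⇔⊨ₛ-translate M R⇔ w (⟨-⟩₂ φ) = ∃₂-cong-⇔ λ v v' →
  (mk⇔ (proj₂ R⇔) (proj₁ R⇔) ⇔-∘ ×-unprotected-⇔ w v v')
  ×-⇔ single-⊨⇔⊨ₛ-translate (M ⊖ (v , v')) (remove-cong-∖ R⇔ v v') w φ

proposition2 : (M : Model) (w : W M) (φ : Form) →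
    (M , single w ⊨ φ) ⇔ (kripke (W M) (R₁ M ∖ R₂ M) (V M) ⊨ₛ translate φ at w)
proposition2 M = single-⊨⇔⊨ₛ-translate M ((λ r → r) , (λ r → r))
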